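{- Let $x\in\mathcal{P}_\infty$ and suppose $\nu_x(n)=2$ for all $n\ge0$. Then $x$ is word isomorphic to the Fibonacci word $f=010010100100101\cdots$, the fixed point of the morphism $0\mapsto01$, $1\mapsto0$.
   Context: All alphabets are finite. A prefixal factorization of an infinite word $x$ is a factorization $x=V_0V_1\cdots$ with every $V_i$ a non-empty prefix of $x$. A finite non-empty word is unbordered if no non-empty word other than itself is both a prefix and a suffix of it; $UP(x)$ is the set of non-empty unbordered prefixes of $x$. $\mathcal{P}_1$ is the set of infinite words admitting a prefixal factorization (equivalently, with $UP(x)$ finite); each $x\in\mathcal{P}_1$ has a unique factorization $x=U_0U_1\cdots$ with $U_i\in UP(x)$. With $UP'(x)=\{U_i:i\ge0\}$, $n_x=\mathrm{card}(UP'(x))$, $UP'(x)$ ordered by index of first occurrence in this factorization, and $\phi:\{1,\dots,n_x\}\to UP'(x)$ the order-preserving bijection, the derived word is $\delta(x)=\phi^{ -1}(U_0)\phi^{ -1}(U_1)\cdots$. Define $\mathcal{P}_{n+1}=\{x\in\mathcal{P}_n:\delta(x)\in\mathcal{P}_n\}$, $\mathcal{P}_\infty=\bigcap_{n\ge1}\mathcal{P}_n$. For an infinite word $y$ with $UP(y)$ finite, $N(y)$ is the length of the longest unbordered prefix of $y$. For $x\in\mathcal{P}_\infty$, $\nu_x(n)=N(\delta^n(x))$ for $n\ge0$, where $\delta^0(x)=x$. Two words $x=x_0x_1\cdots$ over $\mathbb{A}$ and $y$ over $\mathbb{A}'$ are word isomorphic if $y=\psi(x_0)\psi(x_1)\cdots$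 for some bijection $\psi:\mathbb{A}\to\mathbb{A}'$. -}

module Defs where

open import Data.Nat using (ℕ; zero; suc; _+_; _∸_; _≤_; _<_)
open import Data.Fin using (Fin; toℕ) renaming (zero to fz; suc to fs)
open import Data.List using (List; []; _∷_; concatMap)
open import Data.Product using (Σ; ∃; ∃-syntax; _×_; _,_)
open import Data.Unit using (⊤)
open import Relation.Nullary using (¬_)
open import Relation.Binary.PropositionalEquality using (_≡_)
open import Function.Bundles using (_⇔_)

Word : ℕ → Set
Word k = ℕ → Fin k

Unbordered : {k : ℕ} → Word k → ℕ → Set
Unbordered x n =
  1 ≤ n × (∀ m → 1 ≤ m → m < n → ¬ (∀ i → i < m → x i ≡ x ((n ∸ m) + i)))

-- A prefixal factorization of x given by cut points c 0 = 0 < c 1 < c 2 < ...: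
-- the block x[c i .. c (i+1)) is the (non-empty) prefix of x of that length.
IsPrefixalFact : {k : ℕ} → Word k → (ℕ → ℕ) → Set
IsPrefixalFact x c =
  c 0 ≡ 0 ×
  (∀ i → c i < c (suc i)) ×
  (∀ i j → j < c (suc i) ∸ c i → x (c i + j) ≡ x j)

blockLen : (ℕ → ℕ) → ℕ → ℕ
blockLen c i = c (suc i) ∸ c i

P1 : {k : ℕ} → Word k → Set
P1 x = ∃[ c ] IsPrefixalFact x c

IsUPFact : {k : ℕ} → Word k → (ℕ → ℕ) → Set
IsUPFact x c = IsPrefixalFact x c × (∀ i → Unbordered x (blockLen c i))

-- y is the derived word δ(x), over the alphabet Fin m with m = n_x
-- (letters 0,…,n_x-1 instead of 1,…,n_x).  Since every block is a prefix
-- of x, two blocks are equal iff they have the same length.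
IsDerived : {k m : ℕ} → Word k → Word m → Set
IsDerived x y =
  ∃[ c ] (IsUPFact x c ×
    (∀ i j → (y i ≡ y j) ⇔ (blockLen c i ≡ blockLen c j)) ×
    -- letters are numbered by order of first occurrence
    (∀ i a → toℕ (y i) ≡ suc a → ∃[ j ] (j < i × toℕ (y j) ≡ a)) ×
    -- every letter of Fin m codes some block (m = card UP'(x))
    (∀ b → ∃[ i ] (y i ≡ b)))

-- P_n (n ≥ 1); the value at index 0 is irrelevant.
P : ℕ → {k : ℕ} → Word k → Set
P zero x = ⊤
P (suc zero) x = P1 x
P (suc (suc n)) x = P (suc n) x × (∃[ m ] Σ (Word m) λ y → IsDerived x y × P (suc n) y)

Pinf : {k : ℕ} → Word k → Set
Pinf x = ∀ n → 1 ≤ n → P n x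

data DerivIter {k : ℕ} (x : Word k) : ℕ → {m : ℕ} → Word m → Set where
  base : DerivIter x zero x
  step : ∀ {n m l} {y : Word m} {z : Word l} →
         DerivIter x n y → IsDerived y z → DerivIter x (suc n) z

HasN : {k : ℕ} → Word k → ℕ → Set
HasN y l = Unbordered y l × (∀ l' → Unbordered y l' → l' ≤ l)

fibMorph : Fin 2 → List (Fin 2)
fibMorph fz = fz ∷ fs fz ∷ []
fibMorph (fs _) = fz ∷ []

fibIter : ℕ → List (Fin 2)
fibIter zero = fz ∷ []
fibIter (suc n) = concatMap fibMorph (fibIter n)

nthOr : {A : Set} → A → List A → ℕ → A
nthOr d [] _ = d
nthOr d (a ∷ _) zero = a
nthOr d (_ ∷ as) (suc i) = nthOr d as i

-- fibIter n has length ≥ n + 1, so fibIter i has index i; the iterates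
-- are prefixes of each other, so this is the fixed point.
fib : Word 2
fib i = nthOr fz (fibIter i) i

-- If N(y) = 2 then y₀ ≠ y₁ and every unbordered prefix of y has
-- length 1 or 2, so the blocks of the unbordered-prefix factorization of y are
-- y₀y₁ and y₀.  The first block is y₀y₁ (a first block y₀ would make the next
-- block force y₁ = y₀), so δ(y) codes y₀y₁ by its first letter and y₀ by its
-- second: y is the image of δ(y) under the Fibonacci morphism, up to the
-- renaming 0 ↦ y₀, 1 ↦ y₁.  Since N(δⁿ(x)) = 2 for every n, iterating this
-- n times shows that x begins with the renamed n-th Fibonacci iterate.
module Submission where

open import Defs
open import Data.Nat using (ℕ; zero; suc; _+_; _≤_; _<_; z≤n; s≤s)
open import Data.Nat.Properties
  using (+-identityʳ; +-comm; +-suc; m∸n+n≡m; m<n⇒0<n∸m; <⇒≤; ≤-trans; ≤-pred; n≤1+n)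
open import Data.Fin using (Fin) renaming (zero to fz; suc to fs)
open import Data.List using (List; []; _∷_; concatMap; length)
open import Data.Product using (Σ; _×_; _,_)
open import Data.Sum using (_⊎_; inj₁; inj₂)
open import Data.Unit using (⊤; tt)
open import Data.Empty using (⊥-elim)
open import Relation.Binary.PropositionalEquality using (_≡_; _≢_; refl; sym; trans; cong; subst)
open import Function.Definitions using (Injective)
open import Function.Bundles using (Equivalence; _⇔_)

headCode : {k : ℕ} → Word k → Fin 2 → Fin k
headCode y fz = y 0
headCode y (fs _) = y 1

Spells : {k : ℕ} → Word k → (Fin 2 → Fin k) → ℕ → List (Fin 2) → Set
Spells y ψ s [] = ⊤
Spells y ψ s (a ∷ L) = y s ≡ ψ a × Spells y ψ (suc s) L

Spells-lookup : ∀ {k} (y : Word k) ψ s L i → Spells y ψ s L → i < length L →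
                y (s + i) ≡ ψ (nthOr fz L i)
Spells-lookup y ψ s (a ∷ L) zero (ya , _) _ = subst (λ t → y t ≡ ψ a) (sym (+-identityʳ s)) ya
Spells-lookup y ψ s (a ∷ L) (suc i) (_ , rest) (s≤s i<n) =
  subst (λ t → y t ≡ ψ (nthOr fz L i)) (sym (+-suc s i)) (Spells-lookup y ψ (suc s) L i rest i<n)

HasN2⇒head-≢ : {k : ℕ} (y : Word k) → HasN y 2 → y 0 ≢ y 1
HasN2⇒head-≢ y ((_ , unbordered) , _) y₀≡y₁ =
  unbordered 1 (s≤s z≤n) (s≤s (s≤s z≤n)) border
  where
    border : ∀ i → i < 1 → y i ≡ y (1 + i)
    border zero _ = y₀≡y₁
    border (suc i) (s≤s ())

headCode-injective : {k : ℕ} (y : Word k) → y 0 ≢ y 1 → Injective _≡_ _≡_ (headCode y)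
headCode-injective y _ {fz} {fz} _ = refl
headCode-injective y y₀≢y₁ {fz} {fs fz} y₀≡y₁ = ⊥-elim (y₀≢y₁ y₀≡y₁)
headCode-injective y y₀≢y₁ {fs fz} {fz} y₁≡y₀ = ⊥-elim (y₀≢y₁ (sym y₁≡y₀))
headCode-injective y _ {fs fz} {fs fz} _ = refl

HasN2⇒unbordered-1⊎2 : {k : ℕ} (y : Word k) → HasN y 2 → ∀ l → Unbordered y l → l ≡ 1 ⊎ l ≡ 2
HasN2⇒unbordered-1⊎2 y _ zero (() , _)
HasN2⇒unbordered-1⊎2 y _ 1 _ = inj₁ refl
HasN2⇒unbordered-1⊎2 y _ 2 _ = inj₂ refl
HasN2⇒unbordered-1⊎2 y (_ , longest) (suc (suc (suc l))) u with longest _ u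
... | s≤s (s≤s ())

cut-suc : (c : ℕ → ℕ) → ∀ t {l} → c t < c (suc t) → blockLen c t ≡ l → c (suc t) ≡ l + c t
cut-suc c t c<c bl = trans (sym (m∸n+n≡m (<⇒≤ c<c))) (cong (_+ c t) bl)

module Desubstitution {k m : ℕ} {y : Word k} {z : Word m} {c : ℕ → ℕ}
  (hy : HasN y 2) (hz : HasN z 2)
  (c₀≡0 : c 0 ≡ 0)
  (increasing : ∀ i → c i < c (suc i))
  (prefixal : ∀ i j → j < blockLen c i → y (c i + j) ≡ y j)
  (unbordered : ∀ i → Unbordered y (blockLen c i))
  (code : ∀ i j → (z i ≡ z j) ⇔ (blockLen c i ≡ blockLen c j)) where

  block-first-letter : ∀ t {l} → blockLen c t ≡ l → 0 < l → y (c t) ≡ y 0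
  block-first-letter t bl 0<l =
    subst (λ s → y s ≡ y 0) (+-identityʳ (c t)) (prefixal t 0 (subst (0 <_) (sym bl) 0<l))

  block-second-letter : ∀ t → blockLen c t ≡ 2 → y (suc (c t)) ≡ y 1
  block-second-letter t bl =
    subst (λ s → y s ≡ y 1) (+-comm (c t) 1) (prefixal t 1 (subst (1 <_) (sym bl) (s≤s (s≤s z≤n))))

  -- A first block y₀ would make the (non-empty) second block start with y₁ = y₀.
  firstBlock-length : blockLen c 0 ≡ 2
  firstBlock-length with HasN2⇒unbordered-1⊎2 y hy _ (unbordered 0)
  ... | inj₂ bl≡2 = bl≡2
  ... | inj₁ bl≡1 = ⊥-elim (HasN2⇒head-≢ y hy (sym y₁≡y₀))
    where
      c₁≡1 : c 1 ≡ 1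
      c₁≡1 = trans (cut-suc c 0 (increasing 0) bl≡1) (cong suc c₀≡0)
      y₁≡y₀ : y 1 ≡ y 0
      y₁≡y₀ = trans (cong y (sym c₁≡1)) (block-first-letter 1 refl (m<n⇒0<n∸m (increasing 1)))

  z₀-block-length : ∀ t → z t ≡ z 0 → blockLen c t ≡ 2
  z₀-block-length t zt≡z₀ = trans (Equivalence.to (code t 0) zt≡z₀) firstBlock-length

  z₁-block-length : ∀ t → z t ≡ z 1 → blockLen c t ≡ 1
  z₁-block-length t zt≡z₁ with HasN2⇒unbordered-1⊎2 y hy _ (unbordered t)
  ... | inj₁ bl≡1 = bl≡1
  ... | inj₂ bl≡2 = ⊥-elim (HasN2⇒head-≢ z hz (trans (sym zt≡z₀) zt≡z₁))
    where
      zt≡z₀ : z t ≡ z 0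
      zt≡z₀ = Equivalence.from (code t 0) (trans bl≡2 (sym firstBlock-length))

  Spells-fibMorph : ∀ L t → Spells z (headCode z) t L →
                    Spells y (headCode y) (c t) (concatMap fibMorph L)
  Spells-fibMorph [] t _ = tt
  Spells-fibMorph (fz ∷ L) t (zt≡z₀ , rest) =
    block-first-letter t bl≡2 (s≤s z≤n) , block-second-letter t bl≡2 ,
    subst (λ s → Spells y (headCode y) s (concatMap fibMorph L))
          (cut-suc c t (increasing t) bl≡2) (Spells-fibMorph L (suc t) rest)
    where
      bl≡2 : blockLen c t ≡ 2
      bl≡2 = z₀-block-length t zt≡z₀
  Spells-fibMorph (fs _ ∷ L) t (zt≡z₁ , rest) =
    block-first-letter t bl≡1 (s≤s z≤n) ,
    subst (λ s → Spells y (headCode y) s (concatMap fibMorph L))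
          (cut-suc c t (increasing t) bl≡1) (Spells-fibMorph L (suc t) rest)
    where
      bl≡1 : blockLen c t ≡ 1
      bl≡1 = z₁-block-length t zt≡z₁

iterate-Spells-fibIter : ∀ {k} (x : Word k) → (∀ n {m} (y : Word m) → DerivIter x n y → HasN y 2) →
  ∀ n j {m} (y : Word m) → DerivIter x j y → P (suc n) y → Spells y (headCode y) 0 (fibIter n)
iterate-Spells-fibIter x N₂ zero j y x⇝y _ = refl , tt
iterate-Spells-fibIter x N₂ (suc n) j y x⇝y
  (_ , _ , z , y⇝z@(c , ((c₀≡0 , increasing , prefixal) , unbordered) , code , _) , Pz) =
  subst (λ s → Spells y (headCode y) s (fibIter (suc n))) c₀≡0
    (Desubstitution.Spells-fibMorph (N₂ j y x⇝y) (N₂ (suc j) z x⇝z)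
       c₀≡0 increasing prefixal unbordered code (fibIter n) 0
       (iterate-Spells-fibIter x N₂ n (suc j) z x⇝z Pz))
  where
    x⇝z : DerivIter x (suc j) z
    x⇝z = step x⇝y y⇝z

length-≤-concatMap-fibMorph : ∀ L → length L ≤ length (concatMap fibMorph L)
length-≤-concatMap-fibMorph [] = z≤n
length-≤-concatMap-fibMorph (fz ∷ L) = s≤s (≤-trans (length-≤-concatMap-fibMorph L) (n≤1+n _))
length-≤-concatMap-fibMorph (fs _ ∷ L) = s≤s (length-≤-concatMap-fibMorph L)

fibIter-head : ∀ n → Σ (List (Fin 2)) λ r → fibIter n ≡ fz ∷ r
fibIter-head zero = [] , refl
fibIter-head (suc n) with fibIter-head n
... | r , fibIter-n≡0∷r rewrite fibIter-n≡0∷r = _ , refl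

-- fibMorph never shortens a word, and the leading 0 of fibIter n becomes 01.
fibIter-length : ∀ n → n < length (fibIter n)
fibIter-length zero = s≤s z≤n
fibIter-length (suc n) with fibIter-head n | fibIter-length n
... | r , fibIter-n≡0∷r | n<len rewrite fibIter-n≡0∷r =
  s≤s (s≤s (≤-trans (≤-pred n<len) (length-≤-concatMap-fibMorph r)))

mainTheorem5 : {k : ℕ} (x : Word k) → Pinf x →
    (∀ n {m} (y : Word m) → DerivIter x n y → HasN y 2) →
    Σ (Fin 2 → Fin k) λ ψ → Injective _≡_ _≡_ ψ × (∀ n → x n ≡ ψ (fib n))
mainTheorem5 x Pinf-x N₂ =
  headCode x , headCode-injective x (HasN2⇒head-≢ x (N₂ 0 x base)) , x≡fib
  where
    x≡fib : ∀ n → x n ≡ headCode x (fib n)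
    x≡fib n = Spells-lookup x (headCode x) 0 (fibIter n) n
      (iterate-Spells-fibIter x N₂ n 0 x base (Pinf-x (suc n) (s≤s z≤n))) (fibIter-length n)
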